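{- Let $G$ be a graph. If $\ell$ is a leaf in $G$ with support vertex $x$, and $z$ is a leaf with support vertex $y$ such that $N(y)=\{z,x\}$, then $G$ does not have a unique maximum open packing.
   Context: An open packing in a graph is a set of vertices whose open neighborhoods are pairwise disjoint. A leaf is a vertex of degree 1 and its neighbor is its support vertex. $N(v)$ denotes the open neighborhood of $v$. -}

module Defs where

open import Data.Nat using (ℕ; _≤_)
open import Data.Fin using (Fin)
open import Data.Fin.Subset using (Subset; _∈_; ∣_∣)
open import Data.Product using (_×_; Σ; ∃)
open import Data.Sum using (_⊎_)
open import Data.Empty using (⊥)
open import Relation.Nullary using (¬_)
open import Relation.Binary.PropositionalEquality using (_≡_; _≢_)

record Graph (n : ℕ) : Set₁ where
  field
    Adj   : Fin n → Fin n → Set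
    sym   : ∀ {u v} → Adj u v → Adj v u
    irrefl : ∀ {u} → ¬ Adj u u

open Graph public

IsLeafWithSupport : ∀ {n} → Graph n → Fin n → Fin n → Set
IsLeafWithSupport G v s = Adj G v s × (∀ w → Adj G v w → w ≡ s)

IsOpenPacking : ∀ {n} → Graph n → Subset n → Set
IsOpenPacking G S =
  ∀ u v → u ∈ S → v ∈ S → u ≢ v → ∀ w → ¬ (Adj G u w × Adj G v w)

IsMaximumOpenPacking : ∀ {n} → Graph n → Subset n → Set
IsMaximumOpenPacking G S =
  IsOpenPacking G S × (∀ T → IsOpenPacking G T → ∣ T ∣ ≤ ∣ S ∣)

HasUniqueMaximumOpenPacking : ∀ {n} → Graph n → Set
HasUniqueMaximumOpenPacking G =
  Σ _ λ S → IsMaximumOpenPacking G S × (∀ T → IsMaximumOpenPacking G T → T ≡ S)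

module Submission where

-- Suppose S were the unique maximum open packing of G.  Two
-- general moves on a maximum packing S are impossible:
--   * augmentation: adding a vertex b ∉ S whose open neighbourhood meets no
--     neighbourhood of a member of S would give a larger open packing;
--   * exchange: replacing a ∈ S by b ∉ S, where N(b) meets no N(u) for
--     u ∈ S ∖ {a}, gives an open packing of the same size, hence another
--     maximum open packing, which differs from S at a.
-- For the leaf ℓ with support x, N(ℓ) = {x}, so ℓ is separated from every u
-- not adjacent to x.  Splitting on whether some w ≠ ℓ in S is adjacent to x:
--   * if so, exchange w for ℓ;
--   * if not and ℓ ∈ S, exchange ℓ for y (N(y) = {z, x} and z is a leaf);
--   * if not and ℓ ∉ S, augment S by ℓ.  The split on the existence
-- of w is classical; since the goal is a negation it is done under ¬¬.

open import Defs hiding (sym)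
open import Data.Nat using (ℕ; suc; _≤_; _<_)
open import Data.Nat.Properties using (≤⇒≯; n<1+n)
open import Data.Fin using (Fin; zero; suc; _≟_)
open import Data.Fin.Subset using (Subset; _∈_; _∉_; _⊆_; ∣_∣; inside; outside)
open import Data.Fin.Subset.Properties using (_∈?_)
open import Data.Vec using (_∷_; here; there; _[_]≔_)
open import Data.Vec.Properties using ([]=⇒lookup; lookup⇒[]=; lookup∘update; lookup∘update′)
open import Data.Product using (_×_; _,_; proj₁; proj₂; Σ)
open import Data.Sum using (_⊎_; inj₁; inj₂)
open import Data.Empty using (⊥; ⊥-elim)
open import Relation.Nullary using (¬_; Dec; yes; no)
open import Relation.Nullary.Decidable using (¬¬-excluded-middle)
open import Relation.Binary.PropositionalEquality using (_≡_; _≢_; refl; sym; trans; cong; subst)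

insert : ∀ {n} → Fin n → Subset n → Subset n
insert b p = p [ b ]≔ inside

delete : ∀ {n} → Fin n → Subset n → Subset n
delete a p = p [ a ]≔ outside

∈-update⁻ : ∀ {n} {p : Subset n} {b u : Fin n} {s} → u ≢ b → u ∈ p [ b ]≔ s → u ∈ p
∈-update⁻ {p = p} {b} {u} {s} u≢b u∈ =
  lookup⇒[]= u p (trans (sym (lookup∘update′ u≢b p s)) ([]=⇒lookup u∈))

∈-insert⁻ : ∀ {n} {p : Subset n} {b u : Fin n} → u ∈ insert b p → u ≡ b ⊎ u ∈ p
∈-insert⁻ {b = b} {u} u∈ with u ≟ b
... | yes u≡b = inj₁ u≡b
... | no u≢b = inj₂ (∈-update⁻ u≢b u∈)

∉-delete : ∀ {n} {p : Subset n} {a : Fin n} → a ∉ delete a p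
∉-delete {p = p} {a} a∈ with trans (sym ([]=⇒lookup a∈)) (lookup∘update a p outside)
... | ()

delete-⊆ : ∀ {n} {p : Subset n} {a : Fin n} → delete a p ⊆ p
delete-⊆ {a = a} {u} u∈ with u ≟ a
... | yes refl = ⊥-elim (∉-delete u∈)
... | no u≢a = ∈-update⁻ u≢a u∈

∣insert∣ : ∀ {n} (p : Subset n) (b : Fin n) → b ∉ p → ∣ insert b p ∣ ≡ suc ∣ p ∣
∣insert∣ (outside ∷ p) zero    b∉ = refl
∣insert∣ (inside ∷ p)  zero    b∉ = ⊥-elim (b∉ here)
∣insert∣ (outside ∷ p) (suc b) b∉ = ∣insert∣ p b (λ b∈ → b∉ (there b∈))
∣insert∣ (inside ∷ p)  (suc b) b∉ = cong suc (∣insert∣ p b (λ b∈ → b∉ (there b∈)))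

∣delete∣ : ∀ {n} (p : Subset n) (a : Fin n) → a ∈ p → suc ∣ delete a p ∣ ≡ ∣ p ∣
∣delete∣ (inside ∷ p)  zero    here       = refl
∣delete∣ (outside ∷ p) (suc a) (there a∈) = ∣delete∣ p a a∈
∣delete∣ (inside ∷ p)  (suc a) (there a∈) = cong suc (∣delete∣ p a a∈)

module OpenPacking {n : ℕ} (G : Graph n) where

  Separated : Fin n → Fin n → Set
  Separated u v = ∀ w → ¬ (Adj G u w × Adj G v w)

  separated-sym : ∀ {u v : Fin n} → Separated u v → Separated v u
  separated-sym sep w (v~w , u~w) = sep w (u~w , v~w)

  Compatible : Subset n → Fin n → Set
  Compatible S b = ∀ u → u ∈ S → u ≢ b → Separated u b

  packing-⊆ : ∀ {S T : Subset n} → T ⊆ S → IsOpenPacking G S → IsOpenPacking G T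
  packing-⊆ T⊆S P u v u∈ v∈ = P u v (T⊆S u∈) (T⊆S v∈)

  packing-insert : ∀ {S : Subset n} {b : Fin n} →
    IsOpenPacking G S → Compatible S b → IsOpenPacking G (insert b S)
  packing-insert {S} {b} P C u v u∈ v∈ u≢v = cases (∈-insert⁻ u∈) (∈-insert⁻ v∈)
    where
    cases : u ≡ b ⊎ u ∈ S → v ≡ b ⊎ v ∈ S → Separated u v
    cases (inj₁ refl) (inj₁ refl) = ⊥-elim (u≢v refl)
    cases (inj₁ refl) (inj₂ v∈S)  = separated-sym (C v v∈S (λ v≡u → u≢v (sym v≡u)))
    cases (inj₂ u∈S)  (inj₁ refl) = C u u∈S u≢v
    cases (inj₂ u∈S)  (inj₂ v∈S)  = P u v u∈S v∈S u≢v

  no-augmentation : ∀ {S : Subset n} {b : Fin n} →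
    IsMaximumOpenPacking G S → b ∉ S → ¬ Compatible S b
  no-augmentation {S} {b} (P , maximum) b∉S C =
    ≤⇒≯ (maximum (insert b S) (packing-insert P C))
        (subst (∣ S ∣ <_) (sym (∣insert∣ S b b∉S)) (n<1+n ∣ S ∣))

  exchange : ∀ {S : Subset n} {a b : Fin n} →
    IsMaximumOpenPacking G S → a ∈ S → b ∉ S →
    (∀ u → u ∈ S → u ≢ a → Separated u b) →
    IsMaximumOpenPacking G (insert b (delete a S))
  exchange {S} {a} {b} (P , maximum) a∈S b∉S sep =
    packing-insert (packing-⊆ delete-⊆ P) compatible ,
    λ T PT → subst (∣ T ∣ ≤_) (sym same-size) (maximum T PT)
    where
    compatible : Compatible (delete a S) b
    compatible u u∈ _ = sep u (delete-⊆ u∈) (λ { refl → ∉-delete u∈ })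
    same-size : ∣ insert b (delete a S) ∣ ≡ ∣ S ∣
    same-size = trans (∣insert∣ (delete a S) b (λ b∈ → b∉S (delete-⊆ b∈))) (∣delete∣ S a a∈S)

  -- Hence a unique maximum open packing admits no such exchange: the exchanged
  -- packing would be maximum but no longer contain a.
  no-exchange : ∀ {S : Subset n} {a b : Fin n} →
    IsMaximumOpenPacking G S → (∀ T → IsMaximumOpenPacking G T → T ≡ S) →
    a ∈ S → b ∉ S → ¬ (∀ u → u ∈ S → u ≢ a → Separated u b)
  no-exchange {S} {a} {b} maxS unique a∈S b∉S sep =
    ∉-delete (∈-update⁻ a≢b (subst (a ∈_) (sym exchanged≡S) a∈S))
    where
    a≢b : a ≢ b
    a≢b refl = b∉S a∈S
    exchanged≡S : insert b (delete a S) ≡ S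
    exchanged≡S = unique _ (exchange maxS a∈S b∉S sep)

  leaf-separated : ∀ {ℓ x u : Fin n} →
    IsLeafWithSupport G ℓ x → ¬ Adj G u x → Separated u ℓ
  leaf-separated {u = u} (_ , onlyX) u≁x w (u~w , ℓ~w) =
    u≁x (subst (Adj G u) (onlyX w ℓ~w) u~w)

mainTheorem12 : ∀ {n} (G : Graph n) (ℓ x z y : Fin n) →
    IsLeafWithSupport G ℓ x →
    IsLeafWithSupport G z y →
    z ≢ x →
    (∀ w → (Adj G y w → w ≡ z ⊎ w ≡ x) × (w ≡ z ⊎ w ≡ x → Adj G y w)) →
    ¬ HasUniqueMaximumOpenPacking G
mainTheorem12 G ℓ x z y ℓ-leaf (_ , z-leaf) z≢x N[y] (S , maxS@(P , _) , unique) =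
  ¬¬-excluded-middle λ where
    (yes other) → exchange-into-ℓ other
    (no none) → case-ℓ none (ℓ ∈? S)
  where
  open OpenPacking G

  OtherAtX : Set
  OtherAtX = Σ (Fin _) λ w → w ∈ S × Adj G w x × w ≢ ℓ

  y~x : Adj G y x
  y~x = proj₂ (N[y] x) (inj₂ refl)

  y≢ℓ : y ≢ ℓ
  y≢ℓ refl = z≢x (proj₂ ℓ-leaf z (proj₂ (N[y] z) (inj₁ refl)))

  -- If w ∈ S is adjacent to x, then ℓ ∉ S (both w and ℓ see x), and every
  -- other member of S avoids x, so w can be exchanged for ℓ.
  exchange-into-ℓ : OtherAtX → ⊥
  exchange-into-ℓ (w , w∈S , w~x , w≢ℓ) = no-exchange maxS unique w∈S ℓ∉S separated
    where
    ℓ∉S : ℓ ∉ S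
    ℓ∉S ℓ∈S = P ℓ w ℓ∈S w∈S (λ ℓ≡w → w≢ℓ (sym ℓ≡w)) x (proj₁ ℓ-leaf , w~x)
    separated : ∀ u → u ∈ S → u ≢ w → Separated u ℓ
    separated u u∈S u≢w = leaf-separated ℓ-leaf (λ u~x → P u w u∈S w∈S u≢w x (u~x , w~x))

  -- If ℓ ∈ S, then
  -- y ∉ S (y is adjacent to x) and ℓ can be exchanged for y: a common neighbour of y and u ∈ S would be x (excluded)
  -- or z (forcing u = y ∉ S).  If ℓ ∉ S, it can be added to S.
  case-ℓ : ¬ OtherAtX → Dec (ℓ ∈ S) → ⊥
  case-ℓ none (yes ℓ∈S) = no-exchange maxS unique ℓ∈S y∉S separated
    where
    y∉S : y ∉ S
    y∉S y∈S = none (y , y∈S , y~x , y≢ℓ)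
    separated : ∀ u → u ∈ S → u ≢ ℓ → Separated u y
    separated u u∈S u≢ℓ v (u~v , y~v) with proj₁ (N[y] v) y~v
    ... | inj₂ refl = none (u , u∈S , u~v , u≢ℓ)
    ... | inj₁ refl = y∉S (subst (_∈ S) (z-leaf u (Graph.sym G u~v)) u∈S)
  case-ℓ none (no ℓ∉S) = no-augmentation maxS ℓ∉S λ u u∈S u≢ℓ →
    leaf-separated ℓ-leaf (λ u~x → none (u , u∈S , u~x , u≢ℓ))
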